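{- Let $1\le r\le m-1$ be integers and let $S=\left\lfloor\frac{m-1}{r}\right\rfloor+\left\lfloor\frac{m-2}{r-1}\right\rfloor+\dots+\left\lfloor\frac{m-r+1}{2}\right\rfloor+(m-r)=\sum_{i=0}^{r-1}\left\lfloor\frac{m-r+i}{i+1}\right\rfloor$. Suppose the field $\mathbb{F}$ has at least $S+1$ elements. Then for every $r$-uniform weak $(m-r,A)$ subspace design $\{H_1,\dots,H_N\}$ in $\mathbb{F}^m$ with $N\ge A+1$, one has $A\ge S$.
   Context: A collection $\{H_1,\dots,H_N\}$ of linear subspaces of rank $r$ of $\mathbb{F}^m$ is an $r$-uniform weak $(s,A)$ subspace design if for every linear subspace $W\le\mathbb{F}^m$ of rank $s$, the number of indices $i$ with $\mathrm{rank}(H_i\cap W)>0$ is at most $A$. -}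

module Defs where

open import Level using (Level; _⊔_)
open import Data.Nat using (ℕ; zero; suc)
import Data.Nat as ℕ
open import Data.Nat.DivMod using (_/_)
open import Data.Fin using (Fin; zero; suc)
open import Data.List using (map; upTo)
open import Data.Nat.ListAction using (sum)
open import Data.Product using (Σ; ∃; _×_)
open import Relation.Nullary using (¬_)
open import Relation.Binary.PropositionalEquality using (_≡_)
open import Algebra.Bundles using (CommutativeRing)

record Field (c ℓ : Level) : Set (Level.suc (c ⊔ ℓ)) where
  field
    commutativeRing : CommutativeRing c ℓ
  open CommutativeRing commutativeRing public
  field
    1≉0     : ¬ (1# ≈ 0#)
    inverse : ∀ x → ¬ (x ≈ 0#) → ∃ λ y → (x * y) ≈ 1#

S : ℕ → ℕ → ℕ
S m r = sum (map (λ i → (m ℕ.∸ r ℕ.+ i) / suc i) (upTo r))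

module _ {c ℓ} (F : Field c ℓ) where
  open Field F hiding (zero)

  HasAtLeast : ℕ → Set (c ⊔ ℓ)
  HasAtLeast k = Σ (Fin k → Carrier) λ f → ∀ i j → f i ≈ f j → i ≡ j

  Vec : ℕ → Set c
  Vec m = Fin m → Carrier

  ∑ : ∀ {n} → (Fin n → Carrier) → Carrier
  ∑ {zero}  f = 0#
  ∑ {suc n} f = f zero + ∑ (λ i → f (suc i))

  _≈ᵥ_ : ∀ {m} → Vec m → Vec m → Set ℓ
  u ≈ᵥ v = ∀ k → u k ≈ v k

  0ᵥ : ∀ {m} → Vec m
  0ᵥ _ = 0#

  lincomb : ∀ {r m} → (Fin r → Carrier) → (Fin r → Vec m) → Vec m
  lincomb c B k = ∑ (λ j → c j * B j k)

  LinIndep : ∀ {r m} → (Fin r → Vec m) → Set (c ⊔ ℓ)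
  LinIndep {r} B = ∀ (coef : Fin r → Carrier) → lincomb coef B ≈ᵥ 0ᵥ → ∀ j → coef j ≈ 0#

  -- A linear subspace of F^m of rank r, presented by a basis
  -- (r linearly independent vectors); the subspace is their span.
  record Subspace (m r : ℕ) : Set (c ⊔ ℓ) where
    field
      basis : Fin r → Vec m
      indep : LinIndep basis

  _∈_ : ∀ {m r} → Vec m → Subspace m r → Set (c ⊔ ℓ)
  v ∈ H = ∃ λ coef → v ≈ᵥ lincomb coef (Subspace.basis H)

  -- rank (H ∩ W) > 0, i.e. H ∩ W is not the zero subspace
  MeetsNontrivially : ∀ {m r s} → Subspace m r → Subspace m s → Set (c ⊔ ℓ)
  MeetsNontrivially H W = ∃ λ v → ¬ (v ≈ᵥ 0ᵥ) × v ∈ H × v ∈ W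

  -- r-uniform weak (s, A) subspace design {H_1..H_N} in F^m:
  -- for every rank-s subspace W, at most A indices i have rank(H_i ∩ W) > 0,
  -- i.e. there are no A+1 distinct indices all meeting W nontrivially.
  WeakSubspaceDesign : ∀ {m r N} → (Fin N → Subspace m r) → (s A : ℕ) → Set (c ⊔ ℓ)
  WeakSubspaceDesign {m} {r} {N} H s A =
    ∀ (W : Subspace m s) →
      ¬ (Σ (Fin (suc A) → Fin N) λ g →
           (∀ a b → g a ≡ g b → a ≡ b) × (∀ a → MeetsNontrivially (H (g a)) W))

module Submission where

-- The main lemma
-- (`transversal`): any S(q,r) rank-r subspaces of a rank-q space have a common
-- transversal, a rank-(q-r) subspace meeting each of them nontrivially.  By
-- induction on r: the first t = ⌊(q-1)/r⌋ members have at most q-1 basis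
-- vectors, so they lie in a hyperplane Π (`hyperplaneThrough`); each other
-- member meets Π in rank r-1 (`hyperplaneSection`); by `S-step` at most
-- S(q-1,r-1) such sections remain, so induction inside Π gives a transversal W
-- of them, and W meets the first t members since their ranks exceed rank Π
-- (`dimensionMeet`).  A+1 members of a design with A < S(m,r) would thus have
-- a common transversal (`noSmallDesign`).  The field-size hypothesis is unused.
--
-- Subspaces are spans of lists of vectors; a list is independent when it has
-- no nontrivial dependency.  Field equality is undecidable, so the rank
-- arguments (greedy extension, pivot elimination, Steinitz) run in the
-- double-negation monad, harmless as S m r ≤ A is decidable.  A triangular
-- system of separating functionals (`dualSystem`) recovers `LinIndep`.

open import Defs
open import Level using (Level)
open import Data.Nat using (ℕ; suc; _≤_; _<_; _∸_)
open import Data.Fin using (Fin)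

open import Level using (_⊔_)
open import Function using (_∘_)
import Data.Nat as ℕ
open import Data.Nat using (zero; z≤n; s≤s; _≤?_)
import Data.Nat.Properties as ℕₚ
open import Data.Nat.DivMod using (_/_; m/n*n≤m)
open import Data.Nat.ListAction using (sum)
open import Data.Nat.ListAction.Properties using (sum-++)
open import Data.Fin using (zero; suc; inject≤)
open import Data.Fin.Properties using (inject≤-injective)
open import Data.List using (List; []; _∷_; _++_; length; map; take; drop; concat; tabulate; lookup; upTo)
import Data.List.Properties as Listₚ
open import Data.List.Relation.Unary.All as All using (All; []; _∷_)
import Data.List.Relation.Unary.All.Properties as Allₚ
open import Data.List.Relation.Unary.Any using (Any; here; there)
import Data.List.Relation.Unary.Any.Properties as Anyₚ
open import Data.List.Relation.Binary.Pointwise using (Pointwise; []; _∷_; Pointwise-length)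
open import Data.Product using (Σ; ∃; _×_; _,_)
open import Data.Sum using (_⊎_; inj₁; inj₂)
open import Data.Empty using (⊥; ⊥-elim)
open import Relation.Nullary using (¬_; yes; no)
open import Relation.Nullary.Negation using (DoubleNegation; ¬¬-map; negated-stable; contradiction)
open import Relation.Nullary.Decidable using (¬¬-excluded-middle)
open import Relation.Binary.PropositionalEquality as ≡ using (_≡_)

-- Counting facts; ℕ's + is opened only here, as the field's + is used below.
module Counting where
  open import Data.Nat using (_+_)

  -- S(q, r+1) = S(q-1, r) + ⌊(q-1)/(r+1)⌋ when r+1 ≤ q: the summands of
  -- S(q,r+1) with i < r are those of S(q-1,r), and the last one is ⌊(q-1)/(r+1)⌋.
  S-step : ∀ q r → suc r ≤ q → S q (suc r) ≡ S (q ∸ 1) r + (q ∸ 1) / suc r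
  S-step q r r<q = begin
      sum (map summand (upTo (suc r)))
        ≡⟨ ≡.cong (sum ∘ map summand) (≡.sym (Listₚ.upTo-∷ʳ r)) ⟩
      sum (map summand (upTo r ++ r ∷ []))
        ≡⟨ ≡.cong sum (Listₚ.map-++ summand (upTo r) (r ∷ [])) ⟩
      sum (map summand (upTo r) ++ summand r ∷ [])
        ≡⟨ sum-++ (map summand (upTo r)) (summand r ∷ []) ⟩
      sum (map summand (upTo r)) + (summand r + 0)
        ≡⟨ ≡.cong₂ _+_ (≡.cong sum (Listₚ.map-cong summand≡ (upTo r))) last ⟩
      S (q ∸ 1) r + (q ∸ 1) / suc r ∎
    where
      open ≡.≡-Reasoning
      summand : ℕ → ℕ
      summand i = (q ∸ suc r + i) / suc i
      q∸1∸r : q ∸ suc r ≡ q ∸ 1 ∸ r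
      q∸1∸r = ≡.sym (ℕₚ.∸-+-assoc q 1 r)
      summand≡ : ∀ i → summand i ≡ (q ∸ 1 ∸ r + i) / suc i
      summand≡ i = ≡.cong (λ n → (n + i) / suc i) q∸1∸r
      last : summand r + 0 ≡ (q ∸ 1) / suc r
      last = ≡.trans (ℕₚ.+-identityʳ _)
        (≡.cong (_/ suc r) (≡.trans (≡.cong (_+ r) q∸1∸r) (ℕₚ.m∸n+n≡m (ℕₚ.∸-monoˡ-≤ 1 r<q))))

  -- Trimming: if e₁ ≤ n ≤ e₁ + e₂, keeping e₂ ∸ (e₂ ∸ (n ∸ e₁)) of the e₂
  -- vectors together with all e₁ others leaves exactly n.
  trim-size : ∀ {n e₁ e₂} → e₁ ≤ n → n ≤ e₁ + e₂ → (e₂ ∸ (e₂ ∸ (n ∸ e₁))) + e₁ ≡ n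
  trim-size {n} {e₁} e₁≤n n≤e₁+e₂ =
    ≡.trans (≡.cong (_+ e₁) (ℕₚ.m∸[m∸n]≡n (ℕₚ.m≤n+o⇒m∸n≤o n e₁ n≤e₁+e₂))) (ℕₚ.m∸n+n≡m e₁≤n)

  unit-gap : ∀ {e q} → 1 ≤ q → e + (q ∸ 1) ≡ q → e ≡ 1
  unit-gap {e} {suc q} _ e+q≡1+q = ℕₚ.+-cancelʳ-≡ q e 1 e+q≡1+q

  rank-excess : ∀ {r n} → r ≤ n → n < suc r + (n ∸ r)
  rank-excess r≤n = s≤s (ℕₚ.≤-reflexive (≡.sym (ℕₚ.m+[n∸m]≡n r≤n)))

  length-concat : ∀ {a} {A : Set a} k (Ls : List (List A)) →
                  All (λ L → length L ≡ k) Ls → length (concat Ls) ≡ length Ls ℕ.* k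
  length-concat k []       []         = ≡.refl
  length-concat k (L ∷ Ls) (|L| ∷ |Ls|) =
    ≡.trans (Listₚ.length-++ L) (≡.cong₂ _+_ |L| (length-concat k Ls |Ls|))

  first-block : ∀ {a} {A : Set a} n k .{{_ : ℕ.NonZero k}} (Ls : List (List A)) →
                All (λ L → length L ≡ k) Ls → length (concat (take (n / k) Ls)) ≤ n
  first-block n k Ls |Ls| = ℕₚ.≤-trans
    (ℕₚ.≤-reflexive (length-concat k (take (n / k) Ls) (Allₚ.take⁺ (n / k) |Ls|)))
    (ℕₚ.≤-trans (ℕₚ.*-monoˡ-≤ k (ℕₚ.≤-trans (ℕₚ.≤-reflexive (Listₚ.length-take (n / k) Ls))
                                             (ℕₚ.m⊓n≤m (n / k) (length Ls))))
                (m/n*n≤m n k))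

  rest-count : ∀ {a} {A : Set a} q r → suc r ≤ q → (Gs : List A) → length Gs ≤ S q (suc r) →
               length (drop ((q ∸ 1) / suc r) Gs) ≤ S (q ∸ 1) r
  rest-count q r r<q Gs |Gs|≤ = ℕₚ.≤-trans (ℕₚ.≤-reflexive (Listₚ.length-drop t Gs))
    (ℕₚ.≤-trans (ℕₚ.∸-monoˡ-≤ t |Gs|≤)
                (ℕₚ.≤-reflexive (≡.trans (≡.cong (_∸ t) (S-step q r r<q)) (ℕₚ.m+n∸n≡m (S (q ∸ 1) r) t))))
    where t = (q ∸ 1) / suc r

open Counting using (S-step; trim-size; unit-gap; rank-excess; first-block; rest-count)

-- Classical steps (case splits on equality of field elements) are made in the
-- double-negation monad.  The library's ¬¬-Monad is level-monomorphic, so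
-- return and bind are given here level-polymorphically (enabling do-notation).
return : ∀ {a} {A : Set a} → A → DoubleNegation A
return x ¬x = ¬x x

_>>=_ : ∀ {a b} {A : Set a} {B : Set b} →
        DoubleNegation A → (A → DoubleNegation B) → DoubleNegation B
x >>= f = negated-stable (¬¬-map f x)

sequence : ∀ {a p} {A : Set a} {P : A → Set p} {L : List A} →
           All (DoubleNegation ∘ P) L → DoubleNegation (All P L)
sequence []         = return []
sequence (px ∷ pxs) = do
  x  ← px
  xs ← sequence pxs
  return (x ∷ xs)

sequence-Fin : ∀ {p} n {P : Fin n → Set p} → (∀ k → DoubleNegation (P k)) → DoubleNegation (∀ k → P k)
sequence-Fin zero    h = return (λ ())
sequence-Fin (suc n) h = do
  p₀ ← h zero
  ps ← sequence-Fin n (h ∘ suc)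
  return λ { zero → p₀ ; (suc k) → ps k }

traverse : ∀ {a b p q} {A : Set a} {B : Set b} {P : A → Set p} {Q : A → B → Set q} →
           ∀ {Gs} → All P Gs → (∀ {G} → P G → DoubleNegation (Σ B (Q G))) →
           DoubleNegation (Σ (List B) (Pointwise Q Gs))
traverse []       f = return ([] , [])
traverse (p ∷ ps) f = do
  (K , q)   ← f p
  (Ks , qs) ← traverse ps f
  return (K ∷ Ks , q ∷ qs)

module LinearAlgebra {c ℓ} (F : Field c ℓ) (m : ℕ) where
  open Field F hiding (zero)
  open import Relation.Binary.Reasoning.Setoid setoid
  open import Algebra.Properties.Ring ring using (-1*x≈-x; -‿distribˡ-*; -‿involutive)
  open import Algebra.Properties.Group +-group using (inverseˡ-unique; ε⁻¹≈ε)
  open import Algebra.Properties.CommutativeSemigroup +-commutativeSemigroup using (interchange)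
  open import Algebra.Properties.CommutativeSemigroup *-commutativeSemigroup using (x∙yz≈y∙xz)
  open import Algebra.Solver.Ring.NaturalCoefficients.Default commutativeSemiring
    using (solve; _:+_; _:*_; _:=_)

  -- -1 is the nonzero coefficient witnessing that v ∈ ⟨L⟩ makes v ∷ L dependent.
  -1≉0 : ¬ (- 1# ≈ 0#)
  -1≉0 -1≈0 = 1≉0 (begin
    1#       ≈⟨ sym (-‿involutive 1#) ⟩
    - (- 1#) ≈⟨ -‿cong -1≈0 ⟩
    - 0#     ≈⟨ ε⁻¹≈ε ⟩
    0#       ∎)

  undo : ∀ {a b} p → a * b ≈ 1# → (p * b) * a ≈ p
  undo {a} {b} p ab≈1 = begin
    (p * b) * a ≈⟨ *-assoc p b a ⟩
    p * (b * a) ≈⟨ *-congˡ (trans (*-comm b a) ab≈1) ⟩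
    p * 1#      ≈⟨ *-identityʳ p ⟩
    p           ∎

  cancel-pivot : ∀ {a b} p → a * b ≈ 1# → p + (- (p * b)) * a ≈ 0#
  cancel-pivot p ab≈1 =
    trans (+-congˡ (trans (sym (-‿distribˡ-* _ _)) (-‿cong (undo p ab≈1)))) (-‿inverseʳ p)

  solve-for : ∀ {a b x y} → a * b ≈ 1# → a * x + y ≈ 0# → x ≈ (- b) * y
  solve-for {a} {b} {x} {y} ab≈1 ax+y≈0 = begin
    x            ≈⟨ sym (undo x (trans (*-comm b a) ab≈1)) ⟩
    (x * a) * b  ≈⟨ *-congʳ (trans (*-comm x a) (inverseˡ-unique _ _ ax+y≈0)) ⟩
    (- y) * b    ≈⟨ sym (-‿distribˡ-* y b) ⟩
    - (y * b)    ≈⟨ -‿cong (*-comm y b) ⟩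
    - (b * y)    ≈⟨ -‿distribˡ-* b y ⟩
    (- b) * y    ∎

  negate-sum : ∀ {x y} → x + y ≈ 0# → x ≈ (- 1#) * y
  negate-sum {x} {y} x+y≈0 = trans (inverseˡ-unique x y x+y≈0) (sym (-1*x≈-x y))

  shift-rearrange : ∀ p v w β q w′ → (p * v + w) + β * (q * v + w′) ≈ (p + β * q) * v + (w + β * w′)
  shift-rearrange = solve 6 (λ p v w β q w′ →
    (p :* v :+ w) :+ β :* (q :* v :+ w′) := (p :+ β :* q) :* v :+ (w :+ β :* w′)) refl

  collect-pivot : ∀ d x β g y γ → d * (x + β * g) + (y + γ * g) ≈ (d * x + y) + (d * β + γ) * g
  collect-pivot = solve 6 (λ d x β g y γ →
    d :* (x :+ β :* g) :+ (y :+ γ :* g) := (d :* x :+ y) :+ (d :* β :+ γ) :* g) refl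

  combine-+ : ∀ x y s x′ y′ → (x + y) + s * (x′ + y′) ≈ (x + s * x′) + (y + s * y′)
  combine-+ = solve 5 (λ x y s x′ y′ →
    (x :+ y) :+ s :* (x′ :+ y′) := (x :+ s :* x′) :+ (y :+ s :* y′)) refl

  combine-* : ∀ a x s x′ → a * x + s * (a * x′) ≈ a * (x + s * x′)
  combine-* = solve 4 (λ a x s x′ → a :* x :+ s :* (a :* x′) := a :* (x :+ s :* x′)) refl

  V : Set c
  V = Vec F m

  infix 4 _≋_
  _≋_ : V → V → Set ℓ
  _≋_ = _≈ᵥ_ F

  0v : V
  0v = 0ᵥ F

  infixl 6 _⊕_
  _⊕_ : V → V → V
  (x ⊕ y) k = x k + y k

  infixl 7 _⊙_
  _⊙_ : Carrier → V → V
  (a ⊙ x) k = a * x k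

  ≋-refl : ∀ {x} → x ≋ x
  ≋-refl k = refl

  ≋-sym : ∀ {x y} → x ≋ y → y ≋ x
  ≋-sym p k = sym (p k)

  ≋-trans : ∀ {x y z} → x ≋ y → y ≋ z → x ≋ z
  ≋-trans p q k = trans (p k) (q k)

  ⊕-cong : ∀ {x y u v} → x ≋ y → u ≋ v → x ⊕ u ≋ y ⊕ v
  ⊕-cong p q k = +-cong (p k) (q k)

  -- lc cs L = Σᵢ csᵢ · Lᵢ, ignoring surplus entries of either list.
  lc : List Carrier → List V → V
  lc (a ∷ as) (v ∷ vs) = a ⊙ v ⊕ lc as vs
  lc _        _        = 0v

  lc-[] : ∀ cs → lc cs [] ≋ 0v
  lc-[] []      = ≋-refl
  lc-[] (_ ∷ _) = ≋-refl

  infix 4 _∈⟨_⟩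
  _∈⟨_⟩ : V → List V → Set (c ⊔ ℓ)
  x ∈⟨ L ⟩ = ∃ λ cs → x ≋ lc cs L

  _+ᶜ_ : List Carrier → List Carrier → List Carrier
  []       +ᶜ ds       = ds
  (a ∷ as) +ᶜ []       = a ∷ as
  (a ∷ as) +ᶜ (b ∷ bs) = (a + b) ∷ (as +ᶜ bs)

  lc-+ᶜ : ∀ cs ds L → lc (cs +ᶜ ds) L ≋ lc cs L ⊕ lc ds L
  lc-+ᶜ []       ds       L        k = sym (+-identityˡ _)
  lc-+ᶜ (a ∷ as) []       []       k = sym (+-identityˡ _)
  lc-+ᶜ (a ∷ as) []       (v ∷ L)  k = sym (+-identityʳ _)
  lc-+ᶜ (a ∷ as) (b ∷ bs) []       k = sym (+-identityˡ _)
  lc-+ᶜ (a ∷ as) (b ∷ bs) (v ∷ L)  k = begin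
    (a + b) * v k + lc (as +ᶜ bs) L k
      ≈⟨ +-cong (distribʳ (v k) a b) (lc-+ᶜ as bs L k) ⟩
    (a * v k + b * v k) + (lc as L k + lc bs L k)
      ≈⟨ interchange _ _ _ _ ⟩
    (a * v k + lc as L k) + (b * v k + lc bs L k) ∎

  lc-⊙ : ∀ a cs L → a ⊙ lc cs L ≋ lc (map (a *_) cs) L
  lc-⊙ a []       L       k = zeroʳ a
  lc-⊙ a (b ∷ bs) []      k = zeroʳ a
  lc-⊙ a (b ∷ bs) (v ∷ L) k = begin
    a * (b * v k + lc bs L k)        ≈⟨ distribˡ a _ _ ⟩
    a * (b * v k) + a * lc bs L k    ≈⟨ +-cong (sym (*-assoc a b (v k))) (lc-⊙ a bs L k) ⟩
    (a * b) * v k + lc (map (a *_) bs) L k ∎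

  span-cong : ∀ {L x y} → x ≋ y → y ∈⟨ L ⟩ → x ∈⟨ L ⟩
  span-cong x≋y (cs , y≋) = cs , ≋-trans x≋y y≋

  combination∈span : ∀ cs L → lc cs L ∈⟨ L ⟩
  combination∈span cs L = cs , ≋-refl

  span-0 : ∀ {L} → 0v ∈⟨ L ⟩
  span-0 = [] , ≋-refl

  span-⊕ : ∀ {L x y} → x ∈⟨ L ⟩ → y ∈⟨ L ⟩ → x ⊕ y ∈⟨ L ⟩
  span-⊕ {L} (cs , x≋) (ds , y≋) = cs +ᶜ ds , ≋-trans (⊕-cong x≋ y≋) (≋-sym (lc-+ᶜ cs ds L))

  span-⊙ : ∀ {L x} a → x ∈⟨ L ⟩ → a ⊙ x ∈⟨ L ⟩
  span-⊙ {L} a (cs , x≋) = map (a *_) cs , ≋-trans (λ k → *-congˡ (x≋ k)) (lc-⊙ a cs L)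

  span-combination : ∀ {M} cs L → All (_∈⟨ M ⟩) L → lc cs L ∈⟨ M ⟩
  span-combination []       L       _          = span-0
  span-combination (a ∷ as) []      _          = span-0
  span-combination (a ∷ as) (v ∷ L) (v∈ ∷ L⊆) = span-⊕ (span-⊙ a v∈) (span-combination as L L⊆)

  span-mono : ∀ {L M x} → All (_∈⟨ M ⟩) L → x ∈⟨ L ⟩ → x ∈⟨ M ⟩
  span-mono {L} L⊆ (cs , x≋) = span-cong x≋ (span-combination cs L L⊆)

  span-here : ∀ {v L} → v ∈⟨ v ∷ L ⟩
  span-here = (1# ∷ []) , λ k → sym (trans (+-identityʳ _) (*-identityˡ _))

  span-there : ∀ {v L x} → x ∈⟨ L ⟩ → x ∈⟨ v ∷ L ⟩
  span-there (cs , x≋) = (0# ∷ cs) , λ k → trans (x≋ k) (sym (trans (+-congʳ (zeroˡ _)) (+-identityˡ _)))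

  span-self : ∀ L → All (_∈⟨ L ⟩) L
  span-self []      = []
  span-self (v ∷ L) = span-here ∷ All.map span-there (span-self L)

  span-++ʳ : ∀ E {U x} → x ∈⟨ U ⟩ → x ∈⟨ E ++ U ⟩
  span-++ʳ []      x∈ = x∈
  span-++ʳ (e ∷ E) x∈ = span-there (span-++ʳ E x∈)

  span-head : ∀ {v Π x} → x ∈⟨ v ∷ Π ⟩ → Σ Carrier λ a → Σ (List Carrier) λ cs → x ≋ a ⊙ v ⊕ lc cs Π
  span-head ([]       , x≋) = 0# , [] , λ k → trans (x≋ k) (sym (trans (+-congʳ (zeroˡ _)) (+-identityˡ _)))
  span-head ((a ∷ cs) , x≋) = a , cs , x≋

  Dependent : List V → Set (c ⊔ ℓ)
  Dependent L = Σ (List Carrier) λ cs →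
    length cs ≡ length L × lc cs L ≋ 0v × Any (λ a → ¬ a ≈ 0#) cs

  Independent : List V → Set (c ⊔ ℓ)
  Independent L = ¬ Dependent L

  independent-[] : Independent []
  independent-[] ([]    , _ , _ , ())
  independent-[] (_ ∷ _ , () , _)

  independent-tail : ∀ {v L} → Independent (v ∷ L) → Independent L
  independent-tail iL (cs , len , cs·L≈0 , nz) =
    iL ((0# ∷ cs) , ≡.cong suc len , (λ k → trans (+-cong (zeroˡ _) (cs·L≈0 k)) (+-identityˡ 0#)) , there nz)

  fit : List V → List Carrier → List Carrier
  fit []      cs       = []
  fit (_ ∷ L) []       = 0# ∷ fit L []
  fit (_ ∷ L) (a ∷ as) = a ∷ fit L as

  length-fit : ∀ L cs → length (fit L cs) ≡ length L
  length-fit []      cs       = ≡.refl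
  length-fit (_ ∷ L) []       = ≡.cong suc (length-fit L [])
  length-fit (_ ∷ L) (a ∷ as) = ≡.cong suc (length-fit L as)

  lc-fit : ∀ L cs → lc (fit L cs) L ≋ lc cs L
  lc-fit []      cs       = ≋-sym (lc-[] cs)
  lc-fit (v ∷ L) []       k = trans (+-cong (zeroˡ _) (lc-fit L [] k)) (+-identityˡ _)
  lc-fit (v ∷ L) (a ∷ as) k = +-congˡ (lc-fit L as k)

  independent⇒∉span : ∀ {v L} → Independent (v ∷ L) → ¬ v ∈⟨ L ⟩
  independent⇒∉span {v} {L} iL (cs , v≋) =
    iL ((- 1#) ∷ fit L cs , ≡.cong suc (length-fit L cs) , dependency , here -1≉0)
    where
      dependency : (- 1#) ⊙ v ⊕ lc (fit L cs) L ≋ 0v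
      dependency k = trans (+-cong (-1*x≈-x (v k)) (lc-fit L cs k))
                           (trans (+-congʳ (-‿cong (v≋ k))) (-‿inverseˡ _))

  ∉span⇒independent : ∀ {v L} → ¬ v ∈⟨ L ⟩ → Independent L → Independent (v ∷ L)
  ∉span⇒independent v∉ iL ([] , () , _)
  ∉span⇒independent {v} {L} v∉ iL ((a ∷ as) , len , dep , nz) = ¬¬-excluded-middle λ
    { (yes a≈0) → tail-dependent a≈0 nz
    ; (no a≉0)  → let (b , ab≈1) = inverse a a≉0 in
                  v∉ (span-cong (λ k → solve-for ab≈1 (dep k)) (span-⊙ (- b) (combination∈span as L))) }
    where
      tail-dependent : a ≈ 0# → Any (λ a → ¬ a ≈ 0#) (a ∷ as) → ⊥
      tail-dependent a≈0 (here a≉0) = a≉0 a≈0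
      tail-dependent a≈0 (there nz′) = iL (as , ℕₚ.suc-injective len , tail≈0 , nz′)
        where
          tail≈0 : lc as L ≋ 0v
          tail≈0 k = trans (sym (+-identityˡ _))
                           (trans (+-congʳ (sym (trans (*-congʳ a≈0) (zeroˡ _)))) (dep k))

  extend : ∀ U → Independent U → ∀ X → DoubleNegation (Σ (List V) λ E →
             Independent (E ++ U) × All (_∈⟨ E ++ U ⟩) X × All (_∈⟨ X ⟩) E × length E ≤ length X)
  extend U iU []      = return ([] , iU , [] , [] , z≤n)
  extend U iU (x ∷ X) = do
    (E , iEU , X⊆ , E⊆ , |E|≤) ← extend U iU X
    yes x∈ ← ¬¬-excluded-middle
      where no x∉ → return (x ∷ E , ∉span⇒independent x∉ iEU , span-here ∷ All.map span-there X⊆ ,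
                           span-here ∷ All.map span-there E⊆ , s≤s |E|≤)
    return (E , iEU , x∈ ∷ X⊆ , All.map span-there E⊆ , ℕₚ.m≤n⇒m≤1+n |E|≤)

  shift : V → List Carrier → List V → List V
  shift g (β ∷ βs) (x ∷ X) = x ⊕ β ⊙ g ∷ shift g βs X
  shift g []       X       = X
  shift g (β ∷ βs) []      = []

  length-shift : ∀ g βs X → length (shift g βs X) ≡ length X
  length-shift g (β ∷ βs) (x ∷ X) = ≡.cong suc (length-shift g βs X)
  length-shift g []       X       = ≡.refl
  length-shift g (β ∷ βs) []      = ≡.refl

  shift-inside : ∀ {M g} βs {X} → g ∈⟨ M ⟩ → All (_∈⟨ M ⟩) X → All (_∈⟨ M ⟩) (shift g βs X)
  shift-inside (β ∷ βs) g∈ (x∈ ∷ X⊆) = span-⊕ x∈ (span-⊙ β g∈) ∷ shift-inside βs g∈ X⊆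
  shift-inside []       g∈ X⊆         = X⊆
  shift-inside (β ∷ βs) g∈ []         = []

  unshifted : ∀ {x g} → ∃ λ γ → x ≋ x ⊕ γ ⊙ g
  unshifted = 0# , λ k → sym (trans (+-congˡ (zeroˡ _)) (+-identityʳ _))

  shift-combination : ∀ g βs X ds → ∃ λ γ → lc ds (shift g βs X) ≋ lc ds X ⊕ γ ⊙ g
  shift-combination g (β ∷ βs) (x ∷ X) (d ∷ ds) =
    let (γ , γ≈) = shift-combination g βs X ds in
    d * β + γ , λ k → trans (+-congˡ (γ≈ k)) (collect-pivot d (x k) β (g k) (lc ds X k) γ)
  shift-combination g (β ∷ βs) (x ∷ X) [] = unshifted
  shift-combination g []       X       ds = unshifted
  shift-combination g (β ∷ βs) []      ds = unshifted


  shift-independent : ∀ {g X} βs → Independent (g ∷ X) → Independent (shift g βs X)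
  shift-independent {g} {X} βs iX (ds , len , dep , nz) =
    let (γ , γ≈) = shift-combination g βs X ds in
    iX (γ ∷ ds , ≡.cong suc (≡.trans len (length-shift g βs X)) ,
        (λ k → trans (+-comm _ _) (trans (sym (γ≈ k)) (dep k))) , there nz)

  eliminate : ∀ {v Π g a b} cs → a * b ≈ 1# → g ≋ a ⊙ v ⊕ lc cs Π →
              ∀ {X} → All (_∈⟨ v ∷ Π ⟩) X → Σ (List Carrier) λ βs → All (_∈⟨ Π ⟩) (shift g βs X)
  eliminate cs ab≈1 g≋ [] = [] , []
  eliminate {v} {Π} {g} {a} {b} cs ab≈1 g≋ {x ∷ X} (x∈ ∷ X⊆) =
    let (a′ , cs′ , x≋) = span-head x∈
        (βs , shifted⊆) = eliminate cs ab≈1 g≋ X⊆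
        β = - (a′ * b)
        pivot-free : x ⊕ β ⊙ g ≋ lc cs′ Π ⊕ β ⊙ lc cs Π
        pivot-free k = begin
          x k + β * g k
            ≈⟨ +-cong (x≋ k) (*-congˡ (g≋ k)) ⟩
          (a′ * v k + lc cs′ Π k) + β * (a * v k + lc cs Π k)
            ≈⟨ shift-rearrange a′ (v k) _ β a _ ⟩
          (a′ + β * a) * v k + (lc cs′ Π k + β * lc cs Π k)
            ≈⟨ +-congʳ (trans (*-congʳ (cancel-pivot a′ ab≈1)) (zeroˡ (v k))) ⟩
          0# + (lc cs′ Π k + β * lc cs Π k)
            ≈⟨ +-identityˡ _ ⟩
          lc cs′ Π k + β * lc cs Π k ∎
    in β ∷ βs , span-cong pivot-free (span-⊕ (combination∈span cs′ Π) (span-⊙ β (combination∈span cs Π))) ∷ shifted⊆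

  record BasisIn (r : ℕ) (B K : List V) : Set (c ⊔ ℓ) where
    constructor basisIn
    field
      independent : Independent K
      size        : length K ≡ r
      inside      : All (_∈⟨ B ⟩) K

  -- If the first vector g of G
  -- lies in ⟨Π⟩ it is kept; otherwise g has an invertible v-coordinate and is
  -- used as a pivot to shift the remaining vectors into ⟨Π⟩.
  section : ∀ {v Π G s} → All (_∈⟨ v ∷ Π ⟩) G → Independent G → length G ≡ suc s →
            DoubleNegation (Σ (List V) λ K → BasisIn s Π K × All (_∈⟨ G ⟩) K)
  section {v} {Π} {g ∷ G} {s} (g∈ ∷ G⊆) iG len = ¬¬-excluded-middle >>= λ
    { (yes g∈Π) → keep g∈Π s len
    ; (no g∉Π)  → let (a , cs , g≋) = span-head g∈ in ¬¬-excluded-middle >>= λ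
        { (yes a≈0) → contradiction (cs , λ k → trans (g≋ k) (trans (+-congʳ (trans (*-congʳ a≈0) (zeroˡ _))) (+-identityˡ _))) g∉Π
        ; (no a≉0)  → return (pivot cs g≋ (inverse a a≉0)) } }
    where
      keep : g ∈⟨ Π ⟩ → ∀ s → length (g ∷ G) ≡ suc s →
             DoubleNegation (Σ (List V) λ K → BasisIn s Π K × All (_∈⟨ g ∷ G ⟩) K)
      keep g∈Π zero    _   = return ([] , basisIn independent-[] ≡.refl [] , [])
      keep g∈Π (suc s) len = do
        (K , basisIn iK |K| K⊆Π , K⊆G) ← section G⊆ (independent-tail iG) (ℕₚ.suc-injective len)
        return (g ∷ K ,
                basisIn (∉span⇒independent (λ g∈K → independent⇒∉span iG (span-mono K⊆G g∈K)) iK)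
                        (≡.cong suc |K|) (g∈Π ∷ K⊆Π) ,
                span-here ∷ All.map span-there K⊆G)
      pivot : ∀ {a} cs → g ≋ a ⊙ v ⊕ lc cs Π → (∃ λ b → a * b ≈ 1#) →
              Σ (List V) λ K → BasisIn s Π K × All (_∈⟨ g ∷ G ⟩) K
      pivot cs g≋ (b , ab≈1) =
        let (βs , K⊆Π) = eliminate cs ab≈1 g≋ G⊆ in
        shift g βs G ,
        basisIn (shift-independent βs iG) (≡.trans (length-shift g βs G) (ℕₚ.suc-injective len)) K⊆Π ,
        shift-inside βs span-here (All.map span-there (span-self G))

  steinitz : ∀ M L → Independent L → All (_∈⟨ M ⟩) L → DoubleNegation (length L ≤ length M)
  steinitz M       []      _  _         = return z≤n
  steinitz []      (l ∷ L) iL ((cs , l≋) ∷ _) =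
    contradiction (span-cong (λ k → trans (l≋ k) (lc-[] cs k)) span-0) (independent⇒∉span iL)
  steinitz (v ∷ M) (l ∷ L) iL L⊆ = do
    (K , basisIn iK |K| K⊆M , _) ← section L⊆ iL ≡.refl
    |K|≤ ← steinitz M K iK K⊆M
    return (s≤s (≡.subst (_≤ length M) |K| |K|≤))

  independent-dropˡ : ∀ k E {U} → Independent (E ++ U) → Independent (drop k E ++ U)
  independent-dropˡ zero    E       iEU = iEU
  independent-dropˡ (suc k) []      iEU = iEU
  independent-dropˡ (suc k) (e ∷ E) iEU = independent-dropˡ k E (independent-tail iEU)

  -- Any at most q-1 vectors X of a rank-q space ⟨B⟩ lie in a hyperplane Π of
  -- it: a basis E₁ of ⟨X⟩ is extended by vectors E₂ of B to a basis of ⟨B⟩,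
  -- and then vectors of E₂ are dropped until q-1 remain.
  hyperplaneThrough : ∀ {q B} → Independent B → length B ≡ q →
                      ∀ {X} → All (_∈⟨ B ⟩) X → length X ≤ q ∸ 1 →
                      DoubleNegation (Σ (List V) λ Π → BasisIn (q ∸ 1) B Π × All (_∈⟨ Π ⟩) X)
  hyperplaneThrough {q} {B} iB |B| {X} X⊆B |X|≤ = do
    (E₁ , iE₁[] , X⊆E₁[] , E₁⊆X , |E₁|≤) ← extend [] independent-[] X
    let iE₁ : Independent E₁
        iE₁ = ≡.subst Independent (Listₚ.++-identityʳ E₁) iE₁[]
        X⊆E₁ : All (_∈⟨ E₁ ⟩) X
        X⊆E₁ = ≡.subst (λ L → All (_∈⟨ L ⟩) X) (Listₚ.++-identityʳ E₁) X⊆E₁[]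
    (E₂ , iE₂E₁ , B⊆E₂E₁ , E₂⊆B , _) ← extend E₁ iE₁ B
    q≤ ← steinitz (E₂ ++ E₁) B iB B⊆E₂E₁
    let -- the number of vectors of E₂ to drop
        k : ℕ
        k = length E₂ ∸ (q ∸ 1 ∸ length E₁)
        |E₁|≤q-1 : length E₁ ≤ q ∸ 1
        |E₁|≤q-1 = ℕₚ.≤-trans |E₁|≤ |X|≤
        q-1≤ : q ∸ 1 ≤ length E₁ ℕ.+ length E₂
        q-1≤ = ℕₚ.≤-trans (ℕₚ.m∸n≤m q 1)
                 (≡.subst₂ _≤_ |B| (≡.trans (Listₚ.length-++ E₂) (ℕₚ.+-comm (length E₂) _)) q≤)
        |Π| : length (drop k E₂ ++ E₁) ≡ q ∸ 1
        |Π| = ≡.trans (Listₚ.length-++ (drop k E₂))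
                (≡.trans (≡.cong (ℕ._+ length E₁) (Listₚ.length-drop k E₂)) (trim-size |E₁|≤q-1 q-1≤))
    return (drop k E₂ ++ E₁ ,
            basisIn (independent-dropˡ k E₂ iE₂E₁) |Π|
                    (Allₚ.++⁺ (Allₚ.drop⁺ k E₂⊆B) (All.map (span-mono X⊆B) E₁⊆X)) ,
            All.map (span-++ʳ (drop k E₂)) X⊆E₁)

  -- A hyperplane Π of a rank-q space ⟨B⟩ meets every rank-(r+1) subspace G of
  -- ⟨B⟩ in rank at least r: by Steinitz, ⟨B⟩ = ⟨v ∷ Π⟩ for a single further
  -- vector v, and `section` applies.
  hyperplaneSection : ∀ {q B Π G r} → Independent B → length B ≡ q →
                      BasisIn (q ∸ 1) B Π → BasisIn (suc r) B G →
                      DoubleNegation (Σ (List V) λ K → BasisIn r Π K × All (_∈⟨ G ⟩) K)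
  hyperplaneSection {q} {B} {Π} {G} {r} iB |B| (basisIn iΠ |Π| Π⊆B) (basisIn iG |G| G⊆B) = do
    |G|≤|B| ← steinitz B G iG G⊆B
    (E , iEΠ , B⊆EΠ , E⊆B , _) ← extend Π iΠ B
    |EΠ|≤q ← steinitz B (E ++ Π) iEΠ (Allₚ.++⁺ E⊆B Π⊆B)
    q≤|EΠ| ← steinitz (E ++ Π) B iB B⊆EΠ
    let |EΠ| : length (E ++ Π) ≡ length E ℕ.+ (q ∸ 1)
        |EΠ| = ≡.trans (Listₚ.length-++ E) (≡.cong (length E ℕ.+_) |Π|)
        1≤q : 1 ≤ q
        1≤q = ℕₚ.≤-trans (s≤s z≤n) (≡.subst₂ _≤_ |G| |B| |G|≤|B|)
    sectionVia E (unit-gap 1≤q (ℕₚ.≤-antisym (≡.subst₂ _≤_ |EΠ| |B| |EΠ|≤q) (≡.subst₂ _≤_ |B| |EΠ| q≤|EΠ|))) B⊆EΠ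
    where
      sectionVia : ∀ E → length E ≡ 1 → All (_∈⟨ E ++ Π ⟩) B →
                   DoubleNegation (Σ (List V) λ K → BasisIn r Π K × All (_∈⟨ G ⟩) K)
      sectionVia (v ∷ [])    _  B⊆vΠ = section (All.map (span-mono B⊆vΠ) G⊆B) iG |G|
      sectionVia []          () _
      sectionVia (_ ∷ _ ∷ _) () _

  Meets : List V → List V → Set (c ⊔ ℓ)
  Meets G W = Σ V λ x → ¬ x ≋ 0v × x ∈⟨ G ⟩ × x ∈⟨ W ⟩

  meets-mono : ∀ {G K W} → All (_∈⟨ G ⟩) K → Meets K W → Meets G W
  meets-mono K⊆G (x , x≉0 , x∈K , x∈W) = x , x≉0 , span-mono K⊆G x∈K , x∈W

  lc-++ : ∀ G {W} cs → lc cs (G ++ W) ≋ lc (take (length G) cs) G ⊕ lc (drop (length G) cs) W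
  lc-++ []      cs       k = sym (+-identityˡ _)
  lc-++ (g ∷ G) []       k = sym (+-identityˡ _)
  lc-++ (g ∷ G) (a ∷ cs) k = trans (+-congˡ (lc-++ G cs k)) (sym (+-assoc _ _ _))

  -- Subspaces of ⟨Π⟩ whose ranks add up to more than |Π| meet: G ++ W is
  -- dependent by Steinitz, and the G-part x of a dependency lies in ⟨W⟩; x is
  -- nonzero, since otherwise the dependency would restrict to G or to W.
  dimensionMeet : ∀ {Π G W} → Independent G → Independent W → All (_∈⟨ Π ⟩) G → All (_∈⟨ Π ⟩) W →
                  length Π < length G ℕ.+ length W → DoubleNegation (Meets G W)
  dimensionMeet {Π} {G} {W} iG iW G⊆Π W⊆Π |Π|< = dependent >>= common-vector
    where
      dependent : DoubleNegation (Dependent (G ++ W))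
      dependent iGW = steinitz Π (G ++ W) iGW (Allₚ.++⁺ G⊆Π W⊆Π)
                        (ℕₚ.<⇒≱ |Π|< ∘ ≡.subst (_≤ length Π) (Listₚ.length-++ G))
      common-vector : Dependent (G ++ W) → DoubleNegation (Meets G W)
      common-vector (cs , len , dep , nz) = ¬¬-excluded-middle >>= λ
        { (yes x≈0) → contradiction (Anyₚ.++⁻ cs₁ nz′) (restrict x≈0)
        ; (no x≉0)  → return (lc cs₁ G , x≉0 , combination∈span cs₁ G ,
                              span-cong (λ k → negate-sum (x+y≈0 k)) (span-⊙ (- 1#) (combination∈span cs₂ W))) }
        where
          cs₁ cs₂ : List Carrier
          cs₁ = take (length G) cs
          cs₂ = drop (length G) cs
          len′ : length cs ≡ length G ℕ.+ length W
          len′ = ≡.trans len (Listₚ.length-++ G)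
          nz′ : Any (λ a → ¬ a ≈ 0#) (cs₁ ++ cs₂)
          nz′ = ≡.subst (Any _) (≡.sym (Listₚ.take++drop≡id (length G) cs)) nz
          x+y≈0 : lc cs₁ G ⊕ lc cs₂ W ≋ 0v
          x+y≈0 = ≋-trans (≋-sym (lc-++ G cs)) dep
          |cs₁| : length cs₁ ≡ length G
          |cs₁| = ≡.trans (Listₚ.length-take (length G) cs)
                    (ℕₚ.m≤n⇒m⊓n≡m (ℕₚ.≤-trans (ℕₚ.m≤m+n (length G) (length W)) (ℕₚ.≤-reflexive (≡.sym len′))))
          |cs₂| : length cs₂ ≡ length W
          |cs₂| = ≡.trans (Listₚ.length-drop (length G) cs)
                    (≡.trans (≡.cong (_∸ length G) len′) (ℕₚ.m+n∸m≡n (length G) (length W)))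
          restrict : lc cs₁ G ≋ 0v → ¬ (Any (λ a → ¬ a ≈ 0#) cs₁ ⊎ Any (λ a → ¬ a ≈ 0#) cs₂)
          restrict x≈0 (inj₁ nz₁) = iG (cs₁ , |cs₁| , x≈0 , nz₁)
          restrict x≈0 (inj₂ nz₂) = iW (cs₂ , |cs₂| ,
            (λ k → trans (sym (+-identityˡ _)) (trans (+-congʳ (sym (x≈0 k))) (x+y≈0 k))) , nz₂)

  Transversal : ℕ → List V → List (List V) → Set (c ⊔ ℓ)
  Transversal n B Gs = Σ (List V) λ W → BasisIn n B W × All (λ G → Meets G W) Gs

  transversal : ∀ r q {B} → r ≤ q → Independent B → length B ≡ q →
                ∀ Gs → All (BasisIn r B) Gs → length Gs ≤ S q r →
                DoubleNegation (Transversal (q ∸ r) B Gs)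
  transversal zero    q {B} _ iB |B| []      _ _  = return (B , basisIn iB |B| (span-self B) , [])
  transversal zero    q     _ _  _   (_ ∷ _) _ ()
  transversal (suc r) q {B} r<q iB |B| Gs Gs⊆B |Gs|≤ = do
    (Π , Π-hyp , X⊆Π) ← hyperplaneThrough iB |B| X⊆B
                             (first-block (q ∸ 1) (suc r) Gs (All.map BasisIn.size Gs⊆B))
    let basisIn iΠ |Π| Π⊆B = Π-hyp
    (Ks , sections) ← traverse (Allₚ.drop⁺ t Gs⊆B) (hyperplaneSection iB |B| Π-hyp)
    (W , basisIn iW |W| W⊆Π , W-meets-Ks) ←
      transversal r (q ∸ 1) r≤q-1 iΠ |Π| Ks (section-bases sections)
                  (≡.subst (_≤ S (q ∸ 1) r) (Pointwise-length sections) (rest-count q r r<q Gs |Gs|≤))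
    W-meets-first ← sequence (All.map (meet-first |Π| iW W⊆Π |W|)
                                        (All.zip (Allₚ.take⁺ t Gs⊆B , Allₚ.concat⁻ X⊆Π)))
    return (W , basisIn iW (≡.trans |W| (ℕₚ.∸-+-assoc q 1 r)) (All.map (span-mono Π⊆B) W⊆Π) ,
            ≡.subst (All (λ G → Meets G W)) (Listₚ.take++drop≡id t Gs)
                    (Allₚ.++⁺ W-meets-first (section-meets sections W-meets-Ks)))
    where
      -- the first t members go into the hyperplane, the rest are cut by it
      t : ℕ
      t = (q ∸ 1) / suc r
      X : List V
      X = concat (take t Gs)
      r≤q-1 : r ≤ q ∸ 1
      r≤q-1 = ℕₚ.∸-monoˡ-≤ 1 r<q
      X⊆B : All (_∈⟨ B ⟩) X
      X⊆B = Allₚ.concat⁺ (All.map BasisIn.inside (Allₚ.take⁺ t Gs⊆B))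
      Section : List V → List V → List V → Set (c ⊔ ℓ)
      Section Π G K = BasisIn r Π K × All (_∈⟨ G ⟩) K
      section-bases : ∀ {Π Gs′ Ks} → Pointwise (Section Π) Gs′ Ks → All (BasisIn r Π) Ks
      section-bases []              = []
      section-bases ((K , _) ∷ pw) = K ∷ section-bases pw
      section-meets : ∀ {Π Gs′ Ks W} → Pointwise (Section Π) Gs′ Ks →
                      All (λ K → Meets K W) Ks → All (λ G → Meets G W) Gs′
      section-meets []                  []       = []
      section-meets ((_ , K⊆G) ∷ pw) (m ∷ ms) = meets-mono K⊆G m ∷ section-meets pw ms
      -- the members inside the hyperplane meet W by counting ranks
      meet-first : ∀ {Π W} → length Π ≡ q ∸ 1 → Independent W → All (_∈⟨ Π ⟩) W → length W ≡ q ∸ 1 ∸ r →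
                   ∀ {G} → BasisIn (suc r) B G × All (_∈⟨ Π ⟩) G → DoubleNegation (Meets G W)
      meet-first |Π| iW W⊆Π |W| (basisIn iG |G| _ , G⊆Π) =
        dimensionMeet iG iW G⊆Π W⊆Π
          (≡.subst₂ _<_ (≡.sym |Π|) (≡.sym (≡.cong₂ ℕ._+_ |G| |W|)) (rank-excess r≤q-1))

  record Functional : Set (c ⊔ ℓ) where
    field
      apply       : V → Carrier
      apply-cong  : ∀ {x y} → x ≋ y → apply x ≈ apply y
      additive    : ∀ x y → apply (x ⊕ y) ≈ apply x + apply y
      homogeneous : ∀ a x → apply (a ⊙ x) ≈ a * apply x
  open Functional

  apply-0 : ∀ φ → apply φ 0v ≈ 0#
  apply-0 φ = trans (apply-cong φ (λ k → sym (zeroˡ 0#))) (trans (homogeneous φ 0# 0v) (zeroˡ _))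

  coordinate : Fin m → Carrier → Functional
  coordinate k b = record
    { apply       = λ x → b * x k
    ; apply-cong  = λ x≋y → *-congˡ (x≋y k)
    ; additive    = λ x y → distribˡ b (x k) (y k)
    ; homogeneous = λ a x → x∙yz≈y∙xz b a (x k) }

  combine : Functional → Carrier → Functional → Functional
  combine φ s ψ = record
    { apply       = λ x → apply φ x + s * apply ψ x
    ; apply-cong  = λ x≋y → +-cong (apply-cong φ x≋y) (*-congˡ (apply-cong ψ x≋y))
    ; additive    = λ x y → trans (+-cong (additive φ x y) (*-congˡ (additive ψ x y))) (combine-+ _ _ s _ _)
    ; homogeneous = λ a x → trans (+-cong (homogeneous φ a x) (*-congˡ (homogeneous ψ a x))) (combine-* a _ s _) }

  Separates : Functional → V → List V → Set (c ⊔ ℓ)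
  Separates φ v L = apply φ v ≈ 1# × All (λ x → apply φ x ≈ 0#) L

  -- For L = [] some coordinate of v ≠ 0 is inverted.  For l ∷ L, take φ
  -- separating v from L; if φ l ≠ 0, correct it by a functional separating
  -- v - (φ l)⁻¹·l from L.
  separate : ∀ L v → ¬ v ∈⟨ L ⟩ → DoubleNegation (Σ Functional λ φ → Separates φ v L)
  separate [] v v∉ = do
    (k , vₖ≉0) ← λ no-coordinate → sequence-Fin m (λ k vₖ≉0 → no-coordinate (k , vₖ≉0)) (λ v≈0 → v∉ ([] , v≈0))
    let (b , vₖb≈1) = inverse (v k) vₖ≉0
    return (coordinate k b , trans (*-comm b (v k)) vₖb≈1 , [])
  separate (l ∷ L) v v∉ = do
    (φ , φv≈1 , φL≈0) ← separate L v (v∉ ∘ span-there)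
    no φl≉0 ← ¬¬-excluded-middle
      where yes φl≈0 → return (φ , φv≈1 , φl≈0 ∷ φL≈0)
    let (d , φl·d≈1) = inverse (apply φ l) φl≉0
        v′ = v ⊕ (- d) ⊙ l
        v′∉ : ¬ v′ ∈⟨ L ⟩
        v′∉ v′∈ = v∉ (span-cong (λ k → sym (restore k)) (span-⊕ (span-there v′∈) (span-⊙ d span-here)))
    (ψ , ψv′≈1 , ψL≈0) ← separate L v′ v′∉
    let s = - (apply ψ l * d)
    return (combine ψ s φ , combined-v ψ φ φv≈1 ψv′≈1 ,
            cancel-pivot (apply ψ l) φl·d≈1 ∷
            All.zipWith (λ (ψx≈0 , φx≈0) → trans (+-cong ψx≈0 (trans (*-congˡ φx≈0) (zeroʳ s))) (+-identityʳ 0#))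
                        (ψL≈0 , φL≈0))
    where
      restore : ∀ {d} k → (v k + (- d) * l k) + d * l k ≈ v k
      restore {d} k = begin
        (v k + (- d) * l k) + d * l k   ≈⟨ +-assoc _ _ _ ⟩
        v k + ((- d) * l k + d * l k)   ≈⟨ +-congˡ (+-congʳ (sym (-‿distribˡ-* d (l k)))) ⟩
        v k + (- (d * l k) + d * l k)   ≈⟨ +-congˡ (-‿inverseˡ _) ⟩
        v k + 0#                        ≈⟨ +-identityʳ _ ⟩
        v k                             ∎
      combined-v : ∀ {d} ψ φ → apply φ v ≈ 1# → apply ψ (v ⊕ (- d) ⊙ l) ≈ 1# →
                   apply ψ v + (- (apply ψ l * d)) * apply φ v ≈ 1#
      combined-v {d} ψ φ φv≈1 ψv′≈1 = begin
        apply ψ v + (- (apply ψ l * d)) * apply φ v ≈⟨ +-congˡ (trans (*-congˡ φv≈1) (*-identityʳ _)) ⟩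
        apply ψ v + - (apply ψ l * d)               ≈⟨ +-congˡ (-‿cong (*-comm _ _)) ⟩
        apply ψ v + - (d * apply ψ l)               ≈⟨ +-congˡ (-‿distribˡ-* d _) ⟩
        apply ψ v + (- d) * apply ψ l               ≈⟨ +-congˡ (sym (homogeneous ψ (- d) l)) ⟩
        apply ψ v + apply ψ ((- d) ⊙ l)             ≈⟨ sym (additive ψ v _) ⟩
        apply ψ (v ⊕ (- d) ⊙ l)                     ≈⟨ ψv′≈1 ⟩
        1#                                          ∎

  -- A triangular dual system for L: every vector is separated from the later
  -- ones.  Unlike `Independent`, it yields coefficient-wise independence
  -- (`LinIndep`) constructively.
  data DualSystem : List V → Set (c ⊔ ℓ) where
    []  : DualSystem []
    _∷_ : ∀ {v L} → (Σ Functional λ φ → Separates φ v L) → DualSystem L → DualSystem (v ∷ L)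

  dualSystem : ∀ L → Independent L → DoubleNegation (DualSystem L)
  dualSystem []      _  = return []
  dualSystem (v ∷ L) iL = do
    ds  ← dualSystem L (independent-tail iL)
    sep ← separate L v (independent⇒∉span iL)
    return (sep ∷ ds)

  vanishes-on-combination : ∀ φ L → All (λ x → apply φ x ≈ 0#) L →
                            ∀ coef → apply φ (lincomb F coef (lookup L)) ≈ 0#
  vanishes-on-combination φ []      []            coef = apply-0 φ
  vanishes-on-combination φ (x ∷ L) (φx≈0 ∷ φL≈0) coef = begin
    apply φ (coef zero ⊙ x ⊕ lincomb F (coef ∘ suc) (lookup L))
      ≈⟨ additive φ _ _ ⟩
    apply φ (coef zero ⊙ x) + apply φ (lincomb F (coef ∘ suc) (lookup L))
      ≈⟨ +-cong (trans (homogeneous φ _ _) (trans (*-congˡ φx≈0) (zeroʳ _)))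
                (vanishes-on-combination φ L φL≈0 (coef ∘ suc)) ⟩
    0# + 0#
      ≈⟨ +-identityʳ _ ⟩
    0# ∎

  -- Applying the functional of the first vector isolates its coefficient.
  dualSystem⇒LinIndep : ∀ L → DualSystem L → LinIndep F (lookup L)
  dualSystem⇒LinIndep (v ∷ L) ((φ , φv≈1 , φL≈0) ∷ ds) coef comb≈0 = coef≈0
    where
      rest = lincomb F (coef ∘ suc) (lookup L)
      coef₀≈0 : coef zero ≈ 0#
      coef₀≈0 = begin
        coef zero                                 ≈⟨ sym (*-identityʳ _) ⟩
        coef zero * 1#                            ≈⟨ *-congˡ (sym φv≈1) ⟩
        coef zero * apply φ v                     ≈⟨ sym (+-identityʳ _) ⟩
        coef zero * apply φ v + 0#                ≈⟨ +-cong (sym (homogeneous φ _ _)) (sym (vanishes-on-combination φ L φL≈0 (coef ∘ suc))) ⟩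
        apply φ (coef zero ⊙ v) + apply φ rest    ≈⟨ sym (additive φ _ _) ⟩
        apply φ (coef zero ⊙ v ⊕ rest)            ≈⟨ apply-cong φ comb≈0 ⟩
        apply φ 0v                                ≈⟨ apply-0 φ ⟩
        0#                                        ∎
      rest≈0 : rest ≋ 0v
      rest≈0 k = trans (sym (+-identityˡ _))
                       (trans (+-congʳ (sym (trans (*-congʳ coef₀≈0) (zeroˡ _)))) (comb≈0 k))
      coef≈0 : ∀ j → coef j ≈ 0#
      coef≈0 zero    = coef₀≈0
      coef≈0 (suc j) = dualSystem⇒LinIndep L ds (coef ∘ suc) rest≈0 j

  -- The j-th entry of a coefficient list, 0 if there is none.
  coefficient : ∀ {n} → List Carrier → Fin n → Carrier
  coefficient []       _       = 0#
  coefficient (a ∷ as) zero    = a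
  coefficient (a ∷ as) (suc j) = coefficient as j

  lincomb-zeros : ∀ {n} (b : Fin n → V) → 0v ≋ lincomb F (λ _ → 0#) b
  lincomb-zeros {zero}  b k = refl
  lincomb-zeros {suc n} b k = sym (trans (+-cong (zeroˡ _) (sym (lincomb-zeros (b ∘ suc) k))) (+-identityˡ _))

  lc≋lincomb : ∀ {n} (b : Fin n → V) cs → lc cs (tabulate b) ≋ lincomb F (coefficient cs) b
  lc≋lincomb {zero}  b cs       = lc-[] cs
  lc≋lincomb {suc n} b []       = lincomb-zeros b
  lc≋lincomb {suc n} b (a ∷ as) k = +-congˡ (lc≋lincomb (b ∘ suc) as k)

  lincomb≋lc : ∀ {n} (coef : Fin n → Carrier) (b : Fin n → V) → lincomb F coef b ≋ lc (tabulate coef) (tabulate b)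
  lincomb≋lc {zero}  coef b k = refl
  lincomb≋lc {suc n} coef b k = +-congˡ (lincomb≋lc (coef ∘ suc) (b ∘ suc) k)

  span⇒lincomb : ∀ {n} (b : Fin n → V) {x} → x ∈⟨ tabulate b ⟩ → ∃ λ coef → x ≋ lincomb F coef b
  span⇒lincomb b (cs , x≋) = coefficient cs , ≋-trans x≋ (lc≋lincomb b cs)

  nonzero-coefficient : ∀ {n} cs → length cs ≡ n → Any (λ a → ¬ a ≈ 0#) cs →
                        ∃ λ (j : Fin n) → ¬ coefficient cs j ≈ 0#
  nonzero-coefficient {suc n} (a ∷ as) _   (here a≉0) = zero , a≉0
  nonzero-coefficient {suc n} (a ∷ as) len (there nz) =
    let (j , c≉0) = nonzero-coefficient as (ℕₚ.suc-injective len) nz in suc j , c≉0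

  LinIndep⇒independent : ∀ {n} (b : Fin n → V) → LinIndep F b → Independent (tabulate b)
  LinIndep⇒independent b indep (cs , len , dep , nz) =
    let (j , c≉0) = nonzero-coefficient cs (≡.trans len (Listₚ.length-tabulate b)) nz in
    c≉0 (indep (coefficient cs) (≋-trans (≋-sym (lc≋lincomb b cs)) dep) j)

  δ : ∀ {n} → Fin n → Fin n → Carrier
  δ zero    zero    = 1#
  δ zero    (suc _) = 0#
  δ (suc _) zero    = 0#
  δ (suc i) (suc j) = δ i j

  ∑-zero : ∀ {n} (h : Fin n → Carrier) → (∀ j → h j ≈ 0#) → ∑ F h ≈ 0#
  ∑-zero {zero}  h h≈0 = refl
  ∑-zero {suc n} h h≈0 = trans (+-cong (h≈0 zero) (∑-zero (h ∘ suc) (h≈0 ∘ suc))) (+-identityʳ 0#)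

  ∑-δ : ∀ {n} (x : Fin n → Carrier) k → ∑ F (λ j → x j * δ j k) ≈ x k
  ∑-δ {suc n} x zero    =
    trans (+-cong (*-identityʳ _) (∑-zero (λ j → x (suc j) * δ (suc j) zero) (λ j → zeroʳ (x (suc j)))))
          (+-identityʳ _)
  ∑-δ {suc n} x (suc k) = trans (+-cong (zeroʳ _) (∑-δ (x ∘ suc) k)) (+-identityˡ _)

  standardBasis : List V
  standardBasis = tabulate δ

  standardBasis-spans : ∀ x → x ∈⟨ standardBasis ⟩
  standardBasis-spans x = tabulate x , λ k → trans (sym (∑-δ x k)) (lincomb≋lc x δ k)

  standardBasis-independent : Independent standardBasis
  standardBasis-independent = LinIndep⇒independent δ (λ coef comb≈0 j → trans (sym (∑-δ coef j)) (comb≈0 j))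

  noSmallDesign : ∀ r → r ≤ m → ∀ N A (H : Fin N → Subspace F m r) →
                  WeakSubspaceDesign F H (m ∸ r) A → suc A ≤ N → suc A ≤ S m r → ⊥
  noSmallDesign r r≤m N A H design A<N A<S = refutation λ ()
    where
      pick : Fin (suc A) → Fin N
      pick a = inject≤ a A<N
      pick-injective : ∀ a b → pick a ≡ pick b → a ≡ b
      pick-injective a b = inject≤-injective A<N A<N a b
      basis : Fin (suc A) → Fin r → V
      basis a = Subspace.basis (H (pick a))
      bases : List (List V)
      bases = tabulate (tabulate ∘ basis)
      bases-inside : All (BasisIn r standardBasis) bases
      bases-inside = Allₚ.tabulate⁺ {f = tabulate ∘ basis} λ a →
        basisIn (LinIndep⇒independent (basis a) (Subspace.indep (H (pick a))))
                (Listₚ.length-tabulate (basis a))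
                (Allₚ.tabulate⁺ λ _ → standardBasis-spans _)
      |bases|≤ : length bases ≤ S m r
      |bases|≤ = ≡.subst (_≤ S m r) (≡.sym (Listₚ.length-tabulate (tabulate ∘ basis))) A<S
      CommonTransversal : ℕ → Set (c ⊔ ℓ)
      CommonTransversal n = Σ (Subspace F m n) λ Ws → ∀ a → MeetsNontrivially F (H (pick a)) Ws
      asSubspace : ∀ W → DualSystem W → All (λ G → Meets G W) bases → CommonTransversal (length W)
      asSubspace W ds W-meets =
        record { basis = lookup W ; indep = dualSystem⇒LinIndep W ds } , λ a →
          let (x , x≉0 , x∈G , x∈W) = Allₚ.tabulate⁻ {f = tabulate ∘ basis} W-meets a in
          x , x≉0 , span⇒lincomb (basis a) x∈G ,
          span⇒lincomb (lookup W) (≡.subst (x ∈⟨_⟩) (≡.sym (Listₚ.tabulate-lookup W)) x∈W)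
      refutation : DoubleNegation ⊥
      refutation = do
        (W , basisIn iW |W| _ , W-meets) ← transversal r m r≤m standardBasis-independent
                                             (Listₚ.length-tabulate δ) bases bases-inside |bases|≤
        ds ← dualSystem W iW
        let (Ws , meets) = ≡.subst CommonTransversal |W| (asSubspace W ds W-meets)
        return (design Ws (pick , pick-injective , meets))

mainTheorem10 : ∀ {c ℓ : Level} (F : Field c ℓ) (m r : ℕ) →
    1 ≤ r → r < m →
    HasAtLeast F (suc (S m r)) →
    ∀ (N A : ℕ) (H : Fin N → Subspace F m r) →
    WeakSubspaceDesign F H (m ∸ r) A →
    suc A ≤ N →
    S m r ≤ A
mainTheorem10 F m r _ r<m _ N A H design A<N with S m r ≤? A
... | yes S≤A = S≤A
... | no  S≰A =
  ⊥-elim (LinearAlgebra.noSmallDesign F m r (ℕₚ.<⇒≤ r<m) N A H design A<N (ℕₚ.≰⇒> S≰A))
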